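{- Every binary tautological $\rightarrow$-sequent is provable in the system $\mathbf{CL7}$.
   Context: Fix a language with infinitely many propositional atoms. A $\rightarrow$-formula is built from atoms using only the binary connective $\rightarrow$. A $\rightarrow$-sequent is a pair $\Gamma\Rightarrow F$ where $\Gamma$ is a finite (possibly empty) multiset of $\rightarrow$-formulas and $F$ is a $\rightarrow$-formula. A sequent $E_1,\ldots,E_n\Rightarrow F$ is identified with the classical formula $E_1\wedge\cdots\wedge E_n\rightarrow F$; it is tautological iff this is a classical propositional tautology, and binary iff no atom occurs in it more than twice. The system $\mathbf{CL7}$ has as axioms all sequents of the form $\Gamma, F\Rightarrow F$, and exactly two inference rules: Right $\rightarrow$: from $\Gamma, E\Rightarrow F$ infer $\Gamma\Rightarrow E\rightarrow F$; Left $\rightarrow$: from $\Gamma, F\Rightarrow G$ and $\Delta\Rightarrow E$ infer $\Gamma,\Delta, E\rightarrow F\Rightarrow G$ (here $\Gamma,\Delta$ denotes multiset union). (Equivalently, $\mathbf{CL7}$ is the Gentzen-style implicative intuitionistic calculus without the contraction rule.) -}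

module Defs where

open import Data.Nat using (ℕ; _+_; _≤_)
open import Data.Bool using (Bool; true; false; _∧_; not; _∨_)
open import Data.List using (List; []; _∷_; _++_; foldr; map)
open import Data.Nat.ListAction using (sum)
open import Data.Product using (_×_)
open import Relation.Binary.PropositionalEquality using (_≡_)
open import Relation.Nullary using (Dec; yes; no)
open import Data.Nat using (_≟_)
open import Data.List.Relation.Binary.Permutation.Propositional using (_↭_)

infixr 5 _⇒_
data Formula : Set where
  atom : ℕ → Formula
  _⇒_  : Formula → Formula → Formula

-- A sequent Γ ⇒ F with Γ a finite multiset, represented as a list
-- (multisets = lists up to permutation _↭_).
record Sequent : Set where
  constructor _⊢_
  field
    ctx  : List Formula
    goal : Formula
infix 4 _⊢_

Valuation : Set
Valuation = ℕ → Bool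

_⟶ᵇ_ : Bool → Bool → Bool
a ⟶ᵇ b = not a ∨ b

eval : Valuation → Formula → Bool
eval v (atom p) = v p
eval v (A ⇒ B) = eval v A ⟶ᵇ eval v B

evalSeq : Valuation → Sequent → Bool
evalSeq v (Γ ⊢ F) = foldr (λ E b → eval v E ∧ b) true Γ ⟶ᵇ eval v F

Tautological : Sequent → Set
Tautological s = (v : Valuation) → evalSeq v s ≡ true

occ : ℕ → Formula → ℕ
occ p (atom q) with p ≟ q
... | yes _ = 1
... | no  _ = 0
occ p (A ⇒ B) = occ p A + occ p B

occSeq : ℕ → Sequent → ℕ
occSeq p (Γ ⊢ F) = sum (map (occ p) Γ) + occ p F

Binary : Sequent → Set
Binary s = (p : ℕ) → occSeq p s ≤ 2

-- The system CL7. Contexts are multisets; since they are represented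
-- by lists, each rule may conclude any permutation of its context.
data CL7 : List Formula → Formula → Set where
  ax    : ∀ {Γ Θ F} → Θ ↭ (F ∷ Γ) → CL7 Θ F
  right : ∀ {Γ E F} → CL7 (E ∷ Γ) F → CL7 Γ (E ⇒ F)
  left  : ∀ {Γ Δ Θ E F G} → Θ ↭ ((E ⇒ F) ∷ (Γ ++ Δ)) →
          CL7 (F ∷ Γ) G → CL7 Δ E → CL7 Θ G

Provable : Sequent → Set
Provable (Γ ⊢ F) = CL7 Γ F

-- Implications on the right are moved into the context, so the real work is an atomic
-- goal s. Unless some hypothesis has head s, the valuation making only s false refutes
-- the sequent; so there is one, C₁ → ⋯ → Cₖ → s, and by binarity s occurs nowhere else.
-- Making s false then shows that the remaining hypotheses entail every Cᵢ, and the
-- difficulty is to divide them among the Cᵢ without contraction. We therefore solve a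
-- list of goals at once, over a pool in which every hypothesis carries a mask saying to
-- which goals it is available; the goals are proved from left to right, each one
-- consuming the hypotheses its proof uses. A hypothesis is consumed only when its head
-- atom is the current atomic goal; binarity makes that atom fresh in everything else,
-- so setting it true shows that the later goals never needed the hypothesis. The total
-- size of the problem decreases at every step.

module Submission where

open import Defs
open import Data.Bool using (Bool; true; false; not; _∧_; _∨_)
open import Data.Bool.Properties using (∨-zeroʳ)
open import Data.Empty using (⊥-elim)
open import Data.List using (List; []; _∷_; _++_; map; foldr; filterᵇ; drop)
open import Data.List.Relation.Unary.All using (All; []; _∷_)
import Data.List.Relation.Unary.All.Properties as All
import Data.List.Relation.Binary.Permutation.Propositional as ↭
open ↭ using (_↭_; refl; prep; swap; ↭-refl; ↭-sym; ↭-trans)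
open import Data.List.Relation.Binary.Permutation.Propositional.Properties
  using (All-resp-↭; map⁺; filter-↭; ++⁺ʳ; ++⁺ˡ; ++-comm; ++-assoc; shift)
open import Data.Nat using (ℕ; zero; suc; pred; _+_; _≤_; _<_; _≟_; z<s)
open import Data.Nat.ListAction using (sum)
open import Data.Nat.ListAction.Properties using (sum-↭)
open import Data.Nat.Properties
  using (≤-refl; ≤-trans; <-≤-trans; ≤-pred; m≤m+n; m≤n+m; m<m+n; +-suc; +-identityʳ;
         n≤0⇒n≡0; m+n≡0⇒m≡0; m+n≡0⇒n≡0)
open import Data.Nat.Tactic.RingSolver using (solve-∀)
open import Data.Product using (∃; ∃₂; _×_; _,_; proj₁; map₂)
open import Data.Sum as Sum using (_⊎_; inj₁; inj₂)
open import Data.Unit using (⊤; tt)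
open import Function using (_∘_)
open import Relation.Binary.PropositionalEquality
  using (_≡_; _≢_; refl; sym; trans; cong; subst; ≢-sym)
open import Relation.Nullary using (yes; no)
open import Relation.Nullary.Decidable using (T?)

CL7-↭ : ∀ {Θ Θ′ F} → Θ ↭ Θ′ → CL7 Θ F → CL7 Θ′ F
CL7-↭ σ (ax τ)       = ax (↭-trans (↭-sym σ) τ)
CL7-↭ σ (right d)    = right (CL7-↭ (prep _ σ) d)
CL7-↭ σ (left τ d e) = left (↭-trans (↭-sym σ) τ) d e

weakenʳ : ∀ {Θ F} J → CL7 Θ F → CL7 (Θ ++ J) F
weakenʳ J (ax τ)    = ax (++⁺ʳ J τ)
weakenʳ J (right d) = right (weakenʳ J d)
weakenʳ J (left {Γ} {Δ} τ d e) = left (↭-trans (++⁺ʳ J τ) (prep _ regroup)) (weakenʳ J d) e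
  where
  regroup : (Γ ++ Δ) ++ J ↭ (Γ ++ J) ++ Δ
  regroup = ↭-trans (++-assoc Γ Δ J) (↭-trans (++⁺ˡ Γ (++-comm Δ J)) (↭-sym (++-assoc Γ J Δ)))

weaken : ∀ {Θ F} G → CL7 Θ F → CL7 (G ∷ Θ) F
weaken {Θ} G d = CL7-↭ (++-comm Θ (G ∷ [])) (weakenʳ (G ∷ []) d)

Holds : Valuation → List Formula → Set
Holds v = All (λ A → eval v A ≡ true)

infix 4 _⊨_
_⊨_ : List Formula → Formula → Set
Γ ⊨ A = ∀ v → Holds v Γ → eval v A ≡ true

⊨-↭ : ∀ {Γ Γ′ A} → Γ ↭ Γ′ → Γ ⊨ A → Γ′ ⊨ A
⊨-↭ σ ⊨A v h = ⊨A v (All-resp-↭ (↭-sym σ) h)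

⟶ᵇ-elim : ∀ {a b} → a ⟶ᵇ b ≡ true → a ≡ true → b ≡ true
⟶ᵇ-elim hab refl = hab

Holds⇒conjunction : ∀ {v} Γ → Holds v Γ → foldr (λ E b → eval v E ∧ b) true Γ ≡ true
Holds⇒conjunction []      []       = refl
Holds⇒conjunction (_ ∷ Γ) (hA ∷ h) rewrite hA = Holds⇒conjunction Γ h

tautological⇒⊨ : ∀ {Γ F} → Tautological (Γ ⊢ F) → Γ ⊨ F
tautological⇒⊨ {Γ} taut v h = ⟶ᵇ-elim (taut v) (Holds⇒conjunction Γ h)

⟶ᵇ-intro : ∀ a {b} → b ≡ true → a ⟶ᵇ b ≡ true
⟶ᵇ-intro a refl = ∨-zeroʳ (not a)

⟶ᵇ-vacuous : ∀ {a} b → a ≡ false → a ⟶ᵇ b ≡ true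
⟶ᵇ-vacuous b refl = refl

head : Formula → ℕ
head (atom q) = q
head (A ⇒ B)  = head B

eval-head : ∀ {v} A → v (head A) ≡ true → eval v A ≡ true
eval-head (atom q) h = h
eval-head {v} (A ⇒ B) h = ⟶ᵇ-intro (eval v A) (eval-head B h)

occ-atom-self : ∀ s → occ s (atom s) ≡ 1
occ-atom-self s with s ≟ s
... | yes _ = refl
... | no ¬r = ⊥-elim (¬r refl)

occ-head : ∀ A → 1 ≤ occ (head A) A
occ-head (atom q) rewrite occ-atom-self q = ≤-refl
occ-head (A ⇒ B)  = ≤-trans (occ-head B) (m≤n+m _ (occ (head B) A))

Fresh : ℕ → List Formula → Set
Fresh s = All (λ A → occ s A ≡ 0)

infixl 9 _[_≔_]
_[_≔_] : Valuation → ℕ → Bool → Valuation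
(v [ s ≔ b ]) q with s ≟ q
... | yes _ = b
... | no  _ = v q

[≔]-same : ∀ v s b → (v [ s ≔ b ]) s ≡ b
[≔]-same v s b with s ≟ s
... | yes _ = refl
... | no ¬r = ⊥-elim (¬r refl)

[≔]-other : ∀ v {s q} b → s ≢ q → (v [ s ≔ b ]) q ≡ v q
[≔]-other v {s} {q} b s≢q with s ≟ q
... | yes s≡q = ⊥-elim (s≢q s≡q)
... | no  _   = refl

eval-[≔]-fresh : ∀ v {s} b A → occ s A ≡ 0 → eval (v [ s ≔ b ]) A ≡ eval v A
eval-[≔]-fresh v {s} b (atom q) h with s ≟ q
eval-[≔]-fresh v b (atom q) () | yes _
... | no _ = refl
eval-[≔]-fresh v b (A ⇒ B) h
  rewrite eval-[≔]-fresh v b A (m+n≡0⇒m≡0 (occ _ A) h)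
        | eval-[≔]-fresh v b B (m+n≡0⇒n≡0 (occ _ A) h) = refl

Holds-[≔]-fresh : ∀ {v s} b {Γ} → Fresh s Γ → Holds v Γ → Holds (v [ s ≔ b ]) Γ
Holds-[≔]-fresh b []         []       = []
Holds-[≔]-fresh {v} b {A ∷ _} (fA ∷ fΓ) (hA ∷ h) =
  trans (eval-[≔]-fresh v b A fA) hA ∷ Holds-[≔]-fresh b fΓ h

refuting : ℕ → Valuation
refuting s = (λ _ → true) [ s ≔ false ]

eval-[≔true]-head : ∀ v {s} A → head A ≡ s → eval (v [ s ≔ true ]) A ≡ true
eval-[≔true]-head v A refl = eval-head A ([≔]-same v (head A) true)

eval-refuting : ∀ {s} A → head A ≢ s → eval (refuting s) A ≡ true
eval-refuting A h = eval-head A ([≔]-other _ false (≢-sym h))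

-- Otherwise making s false would satisfy C ⇒ E vacuously.
⊨-antecedent : ∀ {Γ C E s} → Fresh s Γ → occ s C ≡ 0 → (C ⇒ E) ∷ Γ ⊨ atom s → Γ ⊨ C
⊨-antecedent {C = C} {E} {s} fΓ fC ⊨s v h with eval (v [ s ≔ false ]) C in eq
... | true  = trans (sym (eval-[≔]-fresh v false C fC)) eq
... | false with () ← trans (sym ([≔]-same v s false))
                            (⊨s _ (⟶ᵇ-vacuous (eval (v [ s ≔ false ]) E) eq ∷ Holds-[≔]-fresh false fΓ h))

-- Pools of hypotheses

-- The i-th entry of a mask tells whether the hypothesis may be used for the i-th goal.
Mask : Set
Mask = List Bool

Entry : Set
Entry = Formula × Mask

Pool : Set
Pool = List Entry

usable : Entry → Bool
usable (_ , b ∷ _) = b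
usable (_ , [])    = false

formulas : Pool → List Formula
formulas = map proj₁

available : Pool → List Formula
available P = formulas (filterᵇ usable P)

advance : Pool → Pool
advance = map (map₂ (drop 1))

repeatHead : Mask → Mask
repeatHead []      = []
repeatHead (b ∷ m) = b ∷ b ∷ m

-- Makes the hypotheses of the current goal available to one more goal inserted in front.
fork : Pool → Pool
fork = map (map₂ repeatHead)

formulas-advance : ∀ P → formulas (advance P) ≡ formulas P
formulas-advance []      = refl
formulas-advance (e ∷ P) = cong (proj₁ e ∷_) (formulas-advance P)

formulas-fork : ∀ P → formulas (fork P) ≡ formulas P
formulas-fork []      = refl
formulas-fork (e ∷ P) = cong (proj₁ e ∷_) (formulas-fork P)

available-fork : ∀ P → available (fork P) ≡ available P
available-fork []                  = refl
available-fork ((f , [])        ∷ P) = available-fork P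
available-fork ((f , false ∷ m) ∷ P) = available-fork P
available-fork ((f , true ∷ m)  ∷ P) = cong (f ∷_) (available-fork P)

advance-fork : ∀ P → advance (fork P) ≡ P
advance-fork []              = refl
advance-fork ((f , [])    ∷ P) = cong ((f , []) ∷_) (advance-fork P)
advance-fork ((f , b ∷ m) ∷ P) = cong ((f , b ∷ m) ∷_) (advance-fork P)

available-↭ : ∀ {P Q} → P ↭ Q → available P ↭ available Q
available-↭ σ = map⁺ proj₁ (filter-↭ (T? ∘ usable) σ)

available-fresh : ∀ {s} P → Fresh s (formulas P) → Fresh s (available P)
available-fresh P h = All.map⁺ (All.filter⁺ (T? ∘ usable) (All.map⁻ h))

advance-fresh : ∀ {s} P → Fresh s (formulas P) → Fresh s (formulas (advance P))
advance-fresh {s} P = subst (Fresh s) (sym (formulas-advance P))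

Holds-available-∷ : ∀ {v f} m {P} → eval v f ≡ true → Holds v (available P) →
                    Holds v (available ((f , m) ∷ P))
Holds-available-∷ []          _  h = h
Holds-available-∷ (false ∷ _) _  h = h
Holds-available-∷ (true ∷ _)  hf h = hf ∷ h

-- Multi-goal problems

Valid : Pool → List Formula → Set
Valid P []       = ⊤
Valid P (A ∷ As) = available P ⊨ A × Valid (advance P) As

data Select : Pool → List Formula → Pool → Set where
  []   : Select [] [] []
  use  : ∀ {f m P Δ R} → Select P Δ R → Select ((f , true ∷ m) ∷ P) (f ∷ Δ) R
  skip : ∀ {e P Δ R} → Select P Δ R → Select (e ∷ P) Δ (e ∷ R)

Solved : Pool → List Formula → Set
Solved P []       = ⊤
Solved P (A ∷ As) = ∃₂ λ Δ R → Select P Δ R × CL7 Δ A × Solved (advance R) As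

skip-all : ∀ P → Select P [] P
skip-all []      = []
skip-all (e ∷ P) = skip (skip-all P)

Select-formulas : ∀ {P Δ R} → Select P Δ R → formulas P ↭ Δ ++ formulas R
Select-formulas []         = ↭-refl
Select-formulas (use sel)  = prep _ (Select-formulas sel)
Select-formulas {Δ = Δ} (skip {R = R} sel) =
  ↭-trans (prep _ (Select-formulas sel)) (↭-sym (shift _ Δ (formulas R)))

Select-↭ : ∀ {P Q Δ R} → P ↭ Q → Select Q Δ R →
           ∃₂ λ Δ′ R′ → Select P Δ′ R′ × Δ′ ↭ Δ × R′ ↭ R
Select-↭ refl sel = _ , _ , sel , ↭-refl , ↭-refl
Select-↭ (prep _ σ) (use sel) with _ , _ , sel′ , τ , ρ ← Select-↭ σ sel =
  _ , _ , use sel′ , prep _ τ , ρ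
Select-↭ (prep _ σ) (skip sel) with _ , _ , sel′ , τ , ρ ← Select-↭ σ sel =
  _ , _ , skip sel′ , τ , prep _ ρ
Select-↭ (swap _ _ σ) (use (use sel)) with _ , _ , sel′ , τ , ρ ← Select-↭ σ sel =
  _ , _ , use (use sel′) , swap _ _ τ , ρ
Select-↭ (swap _ _ σ) (use (skip sel)) with _ , _ , sel′ , τ , ρ ← Select-↭ σ sel =
  _ , _ , skip (use sel′) , prep _ τ , prep _ ρ
Select-↭ (swap _ _ σ) (skip (use sel)) with _ , _ , sel′ , τ , ρ ← Select-↭ σ sel =
  _ , _ , use (skip sel′) , prep _ τ , prep _ ρ
Select-↭ (swap _ _ σ) (skip (skip sel)) with _ , _ , sel′ , τ , ρ ← Select-↭ σ sel =
  _ , _ , skip (skip sel′) , τ , swap _ _ ρ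
Select-↭ (↭.trans σ σ′) sel with _ , _ , sel₁ , τ₁ , ρ₁ ← Select-↭ σ′ sel
                             with _ , _ , sel₂ , τ₂ , ρ₂ ← Select-↭ σ sel₁ =
  _ , _ , sel₂ , ↭-trans τ₂ τ₁ , ↭-trans ρ₂ ρ₁

Select-merge : ∀ {P Δ₁ R₁ Δ₂ R₂} → Select (fork P) Δ₁ R₁ → Select (advance R₁) Δ₂ R₂ →
               ∃ λ Δ → Select P Δ R₂ × Δ ↭ Δ₁ ++ Δ₂
Select-merge {[]} [] [] = [] , [] , ↭-refl
Select-merge {(_ , []) ∷ P} (skip sel₁) (skip sel₂) with Δ , sel , σ ← Select-merge {P} sel₁ sel₂ =
  Δ , skip sel , σ
Select-merge {(f , true ∷ _) ∷ P} (use sel₁) sel₂ with Δ , sel , σ ← Select-merge {P} sel₁ sel₂ =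
  f ∷ Δ , use sel , prep f σ
Select-merge {(f , true ∷ _) ∷ P} {Δ₁} (skip sel₁) (use {Δ = Δ₂} sel₂)
  with Δ , sel , σ ← Select-merge {P} sel₁ sel₂ =
  f ∷ Δ , use sel , ↭-trans (prep f σ) (↭-sym (shift f Δ₁ Δ₂))
Select-merge {(_ , _ ∷ _) ∷ P} (skip sel₁) (skip sel₂) with Δ , sel , σ ← Select-merge {P} sel₁ sel₂ =
  Δ , skip sel , σ

Valid-↭ : ∀ {P Q} As → P ↭ Q → Valid P As → Valid Q As
Valid-↭ []       σ _            = tt
Valid-↭ (A ∷ As) σ (⊨A , valid) = ⊨-↭ {A = A} (available-↭ σ) ⊨A , Valid-↭ As (map⁺ _ σ) valid

Solved-↭ : ∀ {P Q} As → P ↭ Q → Solved Q As → Solved P As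
Solved-↭ []       σ _ = tt
Solved-↭ (A ∷ As) σ (_ , _ , sel , d , sol) with Δ , R , sel′ , τ , ρ ← Select-↭ σ sel =
  Δ , R , sel′ , CL7-↭ (↭-sym τ) d , Solved-↭ As (map⁺ _ ρ) sol

Valid-dead : ∀ {f P} As → Valid P As → Valid ((f , []) ∷ P) As
Valid-dead []       _            = tt
Valid-dead (A ∷ As) (⊨A , valid) = ⊨A , Valid-dead As valid

Solved-dead : ∀ {f P} As → Solved ((f , []) ∷ P) As → Solved P As
Solved-dead []       _                          = tt
Solved-dead (A ∷ As) (Δ , _ , skip sel , d , sol) = Δ , _ , sel , d , Solved-dead As sol

Solved-skip : ∀ {e P} As → Solved P As → Solved (e ∷ P) As
Solved-skip []       _                     = tt
Solved-skip (A ∷ As) (Δ , R , sel , d , sol) = Δ , _ ∷ R , skip sel , d , Solved-skip As sol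

-- Setting s true satisfies f and changes nothing else.
Valid-discharge : ∀ {s f m P} As → head f ≡ s → Fresh s (formulas P) → Fresh s As →
                  Valid ((f , m) ∷ P) As → Valid P As
Valid-discharge []       _  _  _          _            = tt
Valid-discharge {s} {f} {m} {P} (A ∷ As) hf fP (fA ∷ fAs) (⊨A , valid) =
  (λ v h → trans (sym (eval-[≔]-fresh v true A fA))
                 (⊨A _ (Holds-available-∷ m (eval-[≔true]-head v f hf)
                                            (Holds-[≔]-fresh true (available-fresh P fP) h))))
  , Valid-discharge As hf (advance-fresh P fP) fAs valid

Solved-single : ∀ {P} F → Solved P (F ∷ []) → CL7 (formulas P) F
Solved-single _ (Δ , R , sel , d , _) = CL7-↭ (↭-sym (Select-formulas sel)) (weakenʳ (formulas R) d)

Valid-right : ∀ {B C P} As → Valid P ((B ⇒ C) ∷ As) → Valid ((B , true ∷ []) ∷ P) (C ∷ As)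
Valid-right As (⊨B⇒C , valid) = (λ v → λ { (hB ∷ h) → ⟶ᵇ-elim (⊨B⇒C v h) hB })
                              , Valid-dead As valid

Solved-right : ∀ {B C P} As → Solved ((B , true ∷ []) ∷ P) (C ∷ As) → Solved P ((B ⇒ C) ∷ As)
Solved-right As (_ , R , use sel , d , sol)      = _ , R , sel , right d , sol
Solved-right {B} As (_ , _ ∷ R , skip sel , d , sol) =
  _ , R , sel , right (weaken B d) , Solved-dead As sol

Valid-axiom : ∀ {s m P} As → Fresh s (formulas P) → Fresh s As →
              Valid ((atom s , true ∷ m) ∷ P) (atom s ∷ As) → Valid (advance P) As
Valid-axiom {P = P} As fP fAs (_ , valid) = Valid-discharge As refl (advance-fresh P fP) fAs valid

Solved-axiom : ∀ {s m P} As → Solved (advance P) As → Solved ((atom s , true ∷ m) ∷ P) (atom s ∷ As)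
Solved-axiom {P = P} As sol = _ , P , use (skip-all P) , ax ↭-refl , sol

Valid-left : ∀ {s C E m P} As → head E ≡ s → occ s C ≡ 0 → Fresh s (formulas P) → Fresh s As →
             Valid ((C ⇒ E , true ∷ m) ∷ P) (atom s ∷ As) →
             Valid ((E , false ∷ true ∷ []) ∷ fork P) (C ∷ atom s ∷ As)
Valid-left {s} {C} {E} {P = P} As hE fC fP fAs (⊨s , valid) =
  subst (_⊨ C) (sym (available-fork P)) (⊨-antecedent (available-fresh P fP) fC ⊨s)
  , subst (λ Q → Valid ((E , true ∷ []) ∷ Q) (atom s ∷ As)) (sym (advance-fork P))
          ( (λ v → λ { (hE′ ∷ h) → ⊨s v (⟶ᵇ-intro (eval v C) hE′ ∷ h) })
          , Valid-dead As (Valid-discharge As hE (advance-fresh P fP) fAs valid))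

Solved-left : ∀ {C E m P} A As → Solved ((E , false ∷ true ∷ []) ∷ fork P) (C ∷ A ∷ As) →
              Solved ((C ⇒ E , true ∷ m) ∷ P) (A ∷ As)
Solved-left {P = P} A As (Δ₁ , _ , skip sel₁ , d₁ , (_ ∷ Δ₂ , R , use sel₂ , d₂ , sol))
  with Δ , sel , σ ← Select-merge {P} sel₁ sel₂ =
  _ ∷ Δ , R , use sel , left (prep _ (↭-trans σ (++-comm Δ₁ Δ₂))) d₂ d₁ , sol
Solved-left {P = P} A As (Δ₁ , _ , skip sel₁ , d₁ , (Δ₂ , _ , skip sel₂ , d₂ , sol))
  with Δ , sel , σ ← Select-merge {P} sel₁ sel₂ =
  Δ , _ , skip sel , CL7-↭ (↭-trans (++-comm Δ₂ Δ₁) (↭-sym σ)) (weakenʳ Δ₁ d₂)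
  , Solved-skip As (Solved-dead As sol)

size : Formula → ℕ
size (atom _) = 1
size (A ⇒ B)  = suc (size A + size B)

total : (Formula → ℕ) → Pool → List Formula → ℕ
total w P As = sum (map w (formulas P)) + sum (map w As)

BinaryProblem : Pool → List Formula → Set
BinaryProblem P As = ∀ p → total (occ p) P As ≤ 2

total-↭ : ∀ w {P Q} As → P ↭ Q → total w P As ≡ total w Q As
total-↭ w As σ = cong (_+ sum (map w As)) (sum-↭ (map⁺ w (map⁺ proj₁ σ)))

total-axiom : ∀ w f m P A As →
              total w (advance P) As + (w A + w f) ≡ total w ((f , m) ∷ P) (A ∷ As)
total-axiom w f m P A As rewrite formulas-advance P =
  shuffle (w f) (w A) (sum (map w (formulas P))) (sum (map w As))
  where
  shuffle : ∀ f a p g → (p + g) + (a + f) ≡ (f + p) + (a + g)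
  shuffle = solve-∀

module _ (w : Formula → ℕ) (k : ℕ) (w-⇒ : ∀ A B → w (A ⇒ B) ≡ k + (w A + w B)) where

  total-right : ∀ B m P C As → total w ((B , m) ∷ P) (C ∷ As) + k ≡ total w P ((B ⇒ C) ∷ As)
  total-right B m P C As rewrite w-⇒ B C =
    shuffle (w B) (w C) (sum (map w (formulas P))) (sum (map w As)) k
    where
    shuffle : ∀ b c p g k → ((b + p) + (c + g)) + k ≡ p + ((k + (b + c)) + g)
    shuffle = solve-∀

  total-left : ∀ E m′ C m P A As →
               total w ((E , m′) ∷ fork P) (C ∷ A ∷ As) + k ≡ total w ((C ⇒ E , m) ∷ P) (A ∷ As)
  total-left E m′ C m P A As rewrite formulas-fork P | w-⇒ C E =
    shuffle (w E) (w C) (w A) (sum (map w (formulas P))) (sum (map w As)) k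
    where
    shuffle : ∀ e c a p g k → ((e + p) + (c + (a + g))) + k ≡ ((k + (c + e)) + p) + (a + g)
    shuffle = solve-∀

<-of-+suc≡ : ∀ {m n o} → m + suc n ≡ o → m < o
<-of-+suc≡ {m} refl = m<m+n m z<s

smaller : ∀ {n m o d} → m + suc d ≡ o → o < suc n → m < n
smaller eq lt = <-≤-trans (<-of-+suc≡ eq) (≤-pred lt)

fewer : ∀ {m o d} → m + d ≡ o → o ≤ 2 → m ≤ 2
fewer {m} {d = d} refl = ≤-trans (m≤m+n m d)

saturated : ∀ {a b o c} → 1 ≤ a → o ≡ 1 → (a + b) + (o + c) ≤ 2 → a ≡ 1 × b ≡ 0 × c ≡ 0
saturated {suc a} {b} {c = c} _ refl h
  with sum≡0 ← n≤0⇒n≡0 (≤-pred (≤-pred (subst (_≤ 2) (+-suc (suc a + b) c) h))) =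
  cong suc (m+n≡0⇒m≡0 a (m+n≡0⇒m≡0 (a + b) sum≡0)) ,
  m+n≡0⇒n≡0 a (m+n≡0⇒m≡0 (a + b) sum≡0) ,
  m+n≡0⇒n≡0 (a + b) sum≡0

sum-map≡0 : ∀ {A : Set} (f : A → ℕ) xs → sum (map f xs) ≡ 0 → All (λ x → f x ≡ 0) xs
sum-map≡0 f []       _ = []
sum-map≡0 f (x ∷ xs) h = m+n≡0⇒m≡0 (f x) h ∷ sum-map≡0 f xs (m+n≡0⇒n≡0 (f x) h)

-- An atomic goal and a hypothesis with that head use up both occurrences of the atom.
binary-fresh : ∀ {s} f {m P As} → head f ≡ s → total (occ s) ((f , m) ∷ P) (atom s ∷ As) ≤ 2 →
               occ s f ≡ 1 × Fresh s (formulas P) × Fresh s As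
binary-fresh {s} f {P = P} {As} refl bin
  with f≡1 , P≡0 , As≡0 ← saturated (occ-head f) (occ-atom-self s) bin =
  f≡1 , sum-map≡0 (occ s) (formulas P) P≡0 , sum-map≡0 (occ s) As As≡0

m+n≡1⇒m≡0 : ∀ m {n} → 1 ≤ n → m + n ≡ 1 → m ≡ 0
m+n≡1⇒m≡0 zero    _  _ = refl
m+n≡1⇒m≡0 (suc m) {suc n} _ h with () ← m+n≡0⇒n≡0 m (cong pred h)

occ-antecedent : ∀ {s} C E → head E ≡ s → occ s (C ⇒ E) ≡ 1 → occ s C ≡ 0
occ-antecedent {s} C E hE = m+n≡1⇒m≡0 (occ s C) (subst (λ q → 1 ≤ occ q E) hE (occ-head E))

-- The solver

Solver : ℕ → Set
Solver n = ∀ P As → total size P As < n → BinaryProblem P As → Valid P As → Solved P As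

solve-right : ∀ {n} → Solver n → ∀ B C P As → total size P ((B ⇒ C) ∷ As) < suc n →
              BinaryProblem P ((B ⇒ C) ∷ As) → Valid P ((B ⇒ C) ∷ As) → Solved P ((B ⇒ C) ∷ As)
solve-right solve B C P As lt bin valid =
  Solved-right As (solve ((B , true ∷ []) ∷ P) (C ∷ As)
    (smaller (total-right size 1 (λ _ _ → refl) B (true ∷ []) P C As) lt)
    (λ p → fewer (total-right (occ p) 0 (λ _ _ → refl) B (true ∷ []) P C As) (bin p))
    (Valid-right {B} {C} {P} As valid))

solve-headed : ∀ {n s m P As} → Solver n → ∀ f → head f ≡ s →
               total size ((f , true ∷ m) ∷ P) (atom s ∷ As) < suc n →
               BinaryProblem ((f , true ∷ m) ∷ P) (atom s ∷ As) →
               Valid ((f , true ∷ m) ∷ P) (atom s ∷ As) → Solved ((f , true ∷ m) ∷ P) (atom s ∷ As)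
solve-headed {m = m} {P} {As} solve (atom s) refl lt bin valid
  with _ , fP , fAs ← binary-fresh (atom s) {m} {P} {As} refl (bin s) =
  Solved-axiom As (solve (advance P) As
    (smaller (total-axiom size (atom s) m P (atom s) As) lt)
    (λ p → fewer (total-axiom (occ p) (atom s) m P (atom s) As) (bin p))
    (Valid-axiom As fP fAs valid))
solve-headed {s = s} {m} {P} {As} solve (C ⇒ E) hE lt bin valid
  with f≡1 , fP , fAs ← binary-fresh (C ⇒ E) {true ∷ m} {P} {As} hE (bin s) =
  Solved-left (atom s) As (solve ((E , forked) ∷ fork P) (C ∷ atom s ∷ As)
    (smaller (total-left size 1 (λ _ _ → refl) E forked C m P (atom s) As) lt)
    (λ p → fewer (total-left (occ p) 0 (λ _ _ → refl) E forked C m P (atom s) As) (bin p))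
    (Valid-left As hE (occ-antecedent C E hE f≡1) fP fAs valid))
  where
  forked : Mask
  forked = false ∷ true ∷ []

Headed : ℕ → Pool → Set
Headed s P = ∃ λ f → ∃₂ λ m P′ → P ↭ (f , true ∷ m) ∷ P′ × head f ≡ s

Headed-∷ : ∀ {s P} e → Headed s P → Headed s (e ∷ P)
Headed-∷ e (f , m , P′ , σ , hf) = f , m , e ∷ P′ , ↭-trans (prep e σ) (swap e _ ↭-refl) , hf

find-head : ∀ s P → Headed s P ⊎ Holds (refuting s) (available P)
find-head s []                  = inj₂ []
find-head s ((f , [])      ∷ P) = Sum.map₁ (Headed-∷ _) (find-head s P)
find-head s ((f , false ∷ _) ∷ P) = Sum.map₁ (Headed-∷ _) (find-head s P)
find-head s ((f , true ∷ m) ∷ P) with head f ≟ s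
... | yes hf = inj₁ (f , m , P , ↭-refl , hf)
... | no ¬hf = Sum.map (Headed-∷ _) (eval-refuting f ¬hf ∷_) (find-head s P)

solve-below : ∀ n → Solver n
solve-below n       P []             _  _   _     = tt
solve-below (suc n) P ((B ⇒ C) ∷ As) lt bin valid = solve-right (solve-below n) B C P As lt bin valid
solve-below (suc n) P (atom s ∷ As)  lt bin valid with find-head s P
... | inj₂ h with () ← trans (sym ([≔]-same _ s false)) (proj₁ valid _ h)
... | inj₁ (f , m , P′ , σ , hf) =
  Solved-↭ (atom s ∷ As) σ (solve-headed (solve-below n) f hf
    (subst (_< suc n) (total-↭ size (atom s ∷ As) σ) lt)
    (λ p → subst (_≤ 2) (total-↭ (occ p) (atom s ∷ As) σ) (bin p))
    (Valid-↭ (atom s ∷ As) σ valid))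

solve : ∀ P As → BinaryProblem P As → Valid P As → Solved P As
solve P As = solve-below (suc (total size P As)) P As ≤-refl

initial : List Formula → Pool
initial = map (_, true ∷ [])

formulas-initial : ∀ Γ → formulas (initial Γ) ≡ Γ
formulas-initial []      = refl
formulas-initial (A ∷ Γ) = cong (A ∷_) (formulas-initial Γ)

available-initial : ∀ Γ → available (initial Γ) ≡ Γ
available-initial []      = refl
available-initial (A ∷ Γ) = cong (A ∷_) (available-initial Γ)

lemma4p3 : (s : Sequent) → Binary s → Tautological s → Provable s
lemma4p3 (Γ ⊢ F) bin taut =
  subst (λ Θ → CL7 Θ F) (formulas-initial Γ)
        (Solved-single F (solve (initial Γ) (F ∷ []) binary valid))
  where
  binary : BinaryProblem (initial Γ) (F ∷ [])
  binary p rewrite formulas-initial Γ | +-identityʳ (occ p F) = bin p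
  valid : Valid (initial Γ) (F ∷ [])
  valid = subst (_⊨ F) (sym (available-initial Γ)) (tautological⇒⊨ {Γ} {F} taut) , tt
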